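{- Let $k=2K+1\ge5$ be an odd integer and $0\le i\le k-2$. Then $F_k^{(i)}(x,y)=G_k^{(i)}(x,y)$, where $$F_k^{(i)}(x,y)=\sum_{s=1}^{K-1}\left(\frac{ -2}{2s-1}\sum_{n=0}^{k-2s}\binom{i}{k-2s-n}\binom{n+2s-2}{n}B_n\right)x^{2K-2s}y^{2s-1},$$ $$G_k^{(i)}(x,y)=\sum_{s=1}^{K-1}\left(\frac{2}{2s-1}\sum_{n=0}^{k-2s}\binom{k-2-i}{k-2s-n}\binom{n+2s-2}{n}B_n\right)x^{2K-2s}y^{2s-1}.$$
   Context: $B_n$ is the $n$th Bernoulli number, defined by $\frac{t}{e^t-1}=\sum_{n\ge0}B_n\frac{t^n}{n!}$ (so $B_1=-\tfrac12$). Binomial coefficients $\binom{a}{m}$ with $a\ge0$ are the usual ones, equal to $0$ when $m<0$ or $m>a$. -}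

module Defs where

open import Data.Nat using (ℕ; zero; suc; _∸_)
import Data.Nat as ℕ
open import Data.Nat.Combinatorics using (_C_)
open import Data.Integer using (+_)
open import Data.Rational using (ℚ; _/_; 0ℚ; 1ℚ; _*_; -_)
import Data.Rational as ℚ
open import Data.List using (List; []; _∷_; downFrom; zipWith; foldr)
import Data.List as List

⟦_⟧ : ℕ → ℚ
⟦ n ⟧ = + n / 1

∑< : ℕ → (ℕ → ℚ) → ℚ
∑< zero    f = 0ℚ
∑< (suc n) f = ∑< n f ℚ.+ f n

_^_ : ℚ → ℕ → ℚ
x ^ zero  = 1ℚ
x ^ suc n = x * (x ^ n)

-- Bernoulli numbers (convention B₁ = -1/2), via the standard recurrence
--   B₀ = 1,  B_m = -1/(m+1) ∑_{j<m} C(m+1,j) B_j   (m ≥ 1),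
-- equivalent to t/(e^t-1) = ∑ B_n t^n/n!.
-- 'next m prev' computes B_m from prev = [B_{m-1}, ..., B_0].
next : ℕ → List ℚ → ℚ
next zero    prev = 1ℚ
next (suc m) prev =
  - ((+ 1 / suc (suc m)) *
     foldr ℚ._+_ 0ℚ (zipWith (λ j b → ⟦ suc (suc m) C j ⟧ * b) (downFrom (suc m)) prev))

revB : ℕ → List ℚ
revB zero    = []
revB (suc n) = next n (revB n) ∷ revB n

B : ℕ → ℚ
B n = next n (revB n)

-- k = 2K+1.  Inner sums of F and G, for s ≥ 1, with parameter a = i resp. k-2-i:
--   ∑_{n=0}^{k-2s} C(a, k-2s-n) C(n+2s-2, n) B_n
inner : (K a s : ℕ) → ℚ
inner K a s =
  let k = 2 ℕ.* K ℕ.+ 1 in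
  ∑< (suc (k ∸ 2 ℕ.* s))
     (λ n → ⟦ a C (k ∸ 2 ℕ.* s ∸ n) ⟧ * ⟦ (n ℕ.+ 2 ℕ.* s ∸ 2) C n ⟧ * B n)

mono : (K s : ℕ) → ℚ → ℚ → ℚ
mono K s x y = (x ^ (2 ℕ.* K ∸ 2 ℕ.* s)) * (y ^ (2 ℕ.* s ∸ 1))

-- F_k^{(i)}(x,y), k = 2K+1, summing s = 1 .. K-1 (s = suc j, 2s-1 = suc (2j))
F : (K i : ℕ) → ℚ → ℚ → ℚ
F K i x y =
  ∑< (K ∸ 1) (λ j → ((- (+ 2 / suc (2 ℕ.* j))) * inner K i (suc j)) * mono K (suc j) x y)

G : (K i : ℕ) → ℚ → ℚ → ℚ
G K i x y =
  ∑< (K ∸ 1) (λ j → ((+ 2 / suc (2 ℕ.* j)) * inner K (2 ℕ.* K ℕ.+ 1 ∸ 2 ∸ i) (suc j)) * mono K (suc j) x y)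

-- With m = k − 2s and r = 2s − 2, the inner sums of F and G are
-- T(a) = ∑_{n ≤ m} C(a, m − n) C(n + r, n) B_n for a = i and a = k − 2 − i, where i + (k − 2 − i) = m + r.
-- The Bernoulli numbers satisfy ∑_l C(n, l) B_l = (−1)^n B_n: by binomial inversion the difference of the
-- two sides is a fixed point of the binomial transform, hence zero.  Substituting this for B_n in T(a) and
-- exchanging the sums, the coefficient of B_l becomes an alternating Vandermonde convolution, equal to
-- (−1)^m C(b, m − l) C(l + r, l) whenever a + b = m + r.  So T(a) = (−1)^m T(b) = −T(b), as m is odd.

module Submission where

open import Defs
open import Data.Nat using (ℕ; _≤_; _+_; _*_; _∸_)
open import Data.Rational using (ℚ)
open import Relation.Binary.PropositionalEquality using (_≡_)

open import Data.Nat using (zero; suc; _<_; _!; s≤s)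
import Data.Nat as ℕ
import Data.Nat.Properties as ℕ
open import Data.Nat.DivMod using (m/n*n≡m)
open import Data.Nat.Combinatorics
  using ( _C_; nCn≡1; nC1≡n; k>n⇒nCk≡0; nCk+nC[k+1]≡[n+1]C[k+1]; nCk≡nC[n∸k]
        ; nCk≡n!/k![n-k]!; k![n∸k]!∣n!)
open import Data.Nat.Tactic.RingSolver using () renaming (solve-∀ to solve-ℕ)
import Data.Nat.Coprimality as Coprime
open import Data.Integer using (+_)
open import Data.Rational using (mkℚ; 0ℚ; 1ℚ)
import Data.Rational as ℚ
import Data.Rational.Properties as ℚ
open import Data.List using (foldr; zipWith; downFrom)
open import Data.Maybe using (Maybe; just; nothing)
open import Data.Nat.Induction using (<-rec)
open import Data.Product using (_,_)
open import Level using (0ℓ)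
open import Relation.Nullary using (yes; no)
open import Relation.Binary.PropositionalEquality
  using (refl; sym; trans; cong; cong₂; subst; module ≡-Reasoning)
open import Tactic.RingSolver using (solve-∀)
open import Tactic.RingSolver.Core.AlmostCommutativeRing using (AlmostCommutativeRing; fromCommutativeRing)

ℚ-ring : AlmostCommutativeRing 0ℓ 0ℓ
ℚ-ring = fromCommutativeRing ℚ.+-*-commutativeRing is-zero
  where
  is-zero : (x : ℚ) → Maybe (0ℚ ≡ x)
  is-zero x with 0ℚ ℚ.≟ x
  ... | yes 0≡x = just 0≡x
  ... | no _    = nothing

⟦⟧-normal : ∀ n → ⟦ n ⟧ ≡ mkℚ (+ n) 0 (Coprime.sym (Coprime.1-coprimeTo n))
⟦⟧-normal n = ℚ.normalize-coprime (Coprime.sym (Coprime.1-coprimeTo n))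

⟦suc⟧ : ∀ n → ⟦ suc n ⟧ ≡ 1ℚ ℚ.+ ⟦ n ⟧
⟦suc⟧ zero = refl
⟦suc⟧ (suc n) rewrite ⟦⟧-normal (suc n) =
  cong (λ z → + suc (suc z) ℚ./ 1) (sym (ℕ.*-identityʳ n))

⟦+⟧ : ∀ m n → ⟦ m + n ⟧ ≡ ⟦ m ⟧ ℚ.+ ⟦ n ⟧
⟦+⟧ zero    n = sym (ℚ.+-identityˡ ⟦ n ⟧)
⟦+⟧ (suc m) n = begin
  ⟦ suc (m + n) ⟧              ≡⟨ ⟦suc⟧ (m + n) ⟩
  1ℚ ℚ.+ ⟦ m + n ⟧             ≡⟨ cong (1ℚ ℚ.+_) (⟦+⟧ m n) ⟩
  1ℚ ℚ.+ (⟦ m ⟧ ℚ.+ ⟦ n ⟧)     ≡⟨ ℚ.+-assoc 1ℚ ⟦ m ⟧ ⟦ n ⟧ ⟨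
  (1ℚ ℚ.+ ⟦ m ⟧) ℚ.+ ⟦ n ⟧     ≡⟨ cong (ℚ._+ ⟦ n ⟧) (⟦suc⟧ m) ⟨
  ⟦ suc m ⟧ ℚ.+ ⟦ n ⟧ ∎
  where open ≡-Reasoning

⟦*⟧ : ∀ m n → ⟦ m * n ⟧ ≡ ⟦ m ⟧ ℚ.* ⟦ n ⟧
⟦*⟧ zero    n = sym (ℚ.*-zeroˡ ⟦ n ⟧)
⟦*⟧ (suc m) n = begin
  ⟦ n + m * n ⟧                 ≡⟨ ⟦+⟧ n (m * n) ⟩
  ⟦ n ⟧ ℚ.+ ⟦ m * n ⟧           ≡⟨ cong (⟦ n ⟧ ℚ.+_) (⟦*⟧ m n) ⟩
  ⟦ n ⟧ ℚ.+ ⟦ m ⟧ ℚ.* ⟦ n ⟧     ≡⟨ distrib ⟦ n ⟧ ⟦ m ⟧ ⟩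
  (1ℚ ℚ.+ ⟦ m ⟧) ℚ.* ⟦ n ⟧      ≡⟨ cong (ℚ._* ⟦ n ⟧) (⟦suc⟧ m) ⟨
  ⟦ suc m ⟧ ℚ.* ⟦ n ⟧ ∎
  where
  open ≡-Reasoning
  distrib : ∀ (n m : ℚ) → n ℚ.+ m ℚ.* n ≡ (1ℚ ℚ.+ m) ℚ.* n
  distrib = solve-∀ ℚ-ring

⟦⟧*⟦⟧-cong : ∀ {a b c d} → a * b ≡ c * d → ⟦ a ⟧ ℚ.* ⟦ b ⟧ ≡ ⟦ c ⟧ ℚ.* ⟦ d ⟧
⟦⟧*⟦⟧-cong {a} {b} {c} {d} eq = trans (sym (⟦*⟧ a b)) (trans (cong ⟦_⟧ eq) (⟦*⟧ c d))

⟦suc⟧-inverse : ∀ n → ⟦ suc n ⟧ ℚ.* (+ 1 ℚ./ suc n) ≡ 1ℚ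
⟦suc⟧-inverse n =
  trans (cong₂ ℚ._*_ (⟦⟧-normal (suc n)) (ℚ.normalize-coprime (Coprime.1-coprimeTo (suc n))))
        (ℚ.*-inverseʳ (mkℚ (+ suc n) 0 (Coprime.sym (Coprime.1-coprimeTo (suc n)))))

⟦suc⟧*x≡0⇒x≡0 : ∀ n x → ⟦ suc n ⟧ ℚ.* x ≡ 0ℚ → x ≡ 0ℚ
⟦suc⟧*x≡0⇒x≡0 n x eq = begin
  x                    ≡⟨ ℚ.*-identityˡ x ⟨
  1ℚ ℚ.* x             ≡⟨ cong (ℚ._* x) (⟦suc⟧-inverse n) ⟨
  (c ℚ.* c⁻¹) ℚ.* x    ≡⟨ reassoc c c⁻¹ x ⟩
  c⁻¹ ℚ.* (c ℚ.* x)    ≡⟨ cong (c⁻¹ ℚ.*_) eq ⟩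
  c⁻¹ ℚ.* 0ℚ           ≡⟨ ℚ.*-zeroʳ c⁻¹ ⟩
  0ℚ ∎
  where
  open ≡-Reasoning
  c = ⟦ suc n ⟧
  c⁻¹ = + 1 ℚ./ suc n
  reassoc : ∀ (c d x : ℚ) → (c ℚ.* d) ℚ.* x ≡ d ℚ.* (c ℚ.* x)
  reassoc = solve-∀ ℚ-ring

∑<-cong : ∀ n {f g : ℕ → ℚ} → (∀ j → j < n → f j ≡ g j) → ∑< n f ≡ ∑< n g
∑<-cong zero    eq = refl
∑<-cong (suc n) eq =
  cong₂ ℚ._+_ (∑<-cong n (λ j j<n → eq j (ℕ.m<n⇒m<1+n j<n))) (eq n (ℕ.n<1+n n))

∑<-zero : ∀ n {f : ℕ → ℚ} → (∀ j → j < n → f j ≡ 0ℚ) → ∑< n f ≡ 0ℚ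
∑<-zero zero    eq = refl
∑<-zero (suc n) eq =
  cong₂ ℚ._+_ (∑<-zero n (λ j j<n → eq j (ℕ.m<n⇒m<1+n j<n))) (eq n (ℕ.n<1+n n))

∑<-last : ∀ n (f : ℕ → ℚ) → (∀ j → j < n → f j ≡ 0ℚ) → ∑< (suc n) f ≡ f n
∑<-last n f eq = trans (cong (ℚ._+ f n) (∑<-zero n eq)) (ℚ.+-identityˡ (f n))

∑<-+ : ∀ n (f g : ℕ → ℚ) → ∑< n (λ j → f j ℚ.+ g j) ≡ ∑< n f ℚ.+ ∑< n g
∑<-+ zero    f g = refl
∑<-+ (suc n) f g =
  trans (cong (ℚ._+ (f n ℚ.+ g n)) (∑<-+ n f g)) (medial (∑< n f) (∑< n g) (f n) (g n))
  where
  medial : ∀ (a b c d : ℚ) → (a ℚ.+ b) ℚ.+ (c ℚ.+ d) ≡ (a ℚ.+ c) ℚ.+ (b ℚ.+ d)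
  medial = solve-∀ ℚ-ring

∑<-neg : ∀ n (f : ℕ → ℚ) → ∑< n (λ j → ℚ.- f j) ≡ ℚ.- ∑< n f
∑<-neg zero    f = refl
∑<-neg (suc n) f = trans (cong (ℚ._+ ℚ.- f n) (∑<-neg n f)) (sym (ℚ.neg-distrib-+ (∑< n f) (f n)))

∑<-*ˡ : ∀ n (c : ℚ) (f : ℕ → ℚ) → c ℚ.* ∑< n f ≡ ∑< n (λ j → c ℚ.* f j)
∑<-*ˡ zero    c f = ℚ.*-zeroʳ c
∑<-*ˡ (suc n) c f = trans (ℚ.*-distribˡ-+ c (∑< n f) (f n)) (cong (ℚ._+ c ℚ.* f n) (∑<-*ˡ n c f))

∑<-*ʳ : ∀ n (c : ℚ) (f : ℕ → ℚ) → ∑< n f ℚ.* c ≡ ∑< n (λ j → f j ℚ.* c)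
∑<-*ʳ zero    c f = ℚ.*-zeroˡ c
∑<-*ʳ (suc n) c f = trans (ℚ.*-distribʳ-+ c (∑< n f) (f n)) (cong (ℚ._+ f n ℚ.* c) (∑<-*ʳ n c f))

∑<-split : ∀ m n (f : ℕ → ℚ) → ∑< (m + n) f ≡ ∑< m f ℚ.+ ∑< n (λ p → f (m + p))
∑<-split m zero    f = trans (cong (λ k → ∑< k f) (ℕ.+-identityʳ m)) (sym (ℚ.+-identityʳ (∑< m f)))
∑<-split m (suc n) f = begin
  ∑< (m + suc n) f                                   ≡⟨ cong (λ k → ∑< k f) (ℕ.+-suc m n) ⟩
  ∑< (m + n) f ℚ.+ f (m + n)                         ≡⟨ cong (ℚ._+ f (m + n)) (∑<-split m n f) ⟩
  (∑< m f ℚ.+ ∑< n (λ p → f (m + p))) ℚ.+ f (m + n)  ≡⟨ ℚ.+-assoc (∑< m f) _ (f (m + n)) ⟩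
  ∑< m f ℚ.+ ∑< (suc n) (λ p → f (m + p)) ∎
  where open ≡-Reasoning

∑<-drop : ∀ m n (f : ℕ → ℚ) → (∀ j → j < m → f j ≡ 0ℚ) →
          ∑< (m + n) f ≡ ∑< n (λ p → f (m + p))
∑<-drop m n f eq =
  trans (∑<-split m n f) (trans (cong (ℚ._+ rest) (∑<-zero m eq)) (ℚ.+-identityˡ rest))
  where rest = ∑< n (λ p → f (m + p))

∑<-trim : ∀ {m n} (f : ℕ → ℚ) → m ≤ n → (∀ p → f (m + p) ≡ 0ℚ) → ∑< n f ≡ ∑< m f
∑<-trim {m} f m≤n vanish with ℕ.m≤n⇒∃[o]m+o≡n m≤n
... | d , refl =
  trans (∑<-split m d f)
        (trans (cong (∑< m f ℚ.+_) (∑<-zero d (λ p _ → vanish p))) (ℚ.+-identityʳ (∑< m f)))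

∑<-swap : ∀ m n (f : ℕ → ℕ → ℚ) →
          ∑< m (λ i → ∑< n (f i)) ≡ ∑< n (λ j → ∑< m (λ i → f i j))
∑<-swap zero    n f = sym (∑<-zero n (λ _ _ → refl))
∑<-swap (suc m) n f =
  trans (cong (ℚ._+ ∑< n (f m)) (∑<-swap m n f)) (sym (∑<-+ n (λ j → ∑< m (λ i → f i j)) (f m)))

sign : ℕ → ℚ
sign zero    = 1ℚ
sign (suc n) = ℚ.- sign n

sign-+ : ∀ m n → sign (m + n) ≡ sign m ℚ.* sign n
sign-+ zero    n = sym (ℚ.*-identityˡ (sign n))
sign-+ (suc m) n = trans (cong ℚ.-_ (sign-+ m n)) (ℚ.neg-distribˡ-* (sign m) (sign n))

sign-*-sign : ∀ n → sign n ℚ.* sign n ≡ 1ℚ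
sign-*-sign zero    = refl
sign-*-sign (suc n) = trans (neg*neg (sign n)) (sign-*-sign n)
  where
  neg*neg : ∀ (a : ℚ) → (ℚ.- a) ℚ.* (ℚ.- a) ≡ a ℚ.* a
  neg*neg = solve-∀ ℚ-ring

sign-odd : ∀ n → sign (suc (2 * n)) ≡ ℚ.- 1ℚ
sign-odd n = cong ℚ.-_ (begin
  sign (n + (n + 0))       ≡⟨ cong (λ k → sign (n + k)) (ℕ.+-identityʳ n) ⟩
  sign (n + n)             ≡⟨ sign-+ n n ⟩
  sign n ℚ.* sign n        ≡⟨ sign-*-sign n ⟩
  1ℚ ∎)
  where open ≡-Reasoning

δ₁ : ℕ → ℚ
δ₁ 1 = 1ℚ
δ₁ _ = 0ℚ

sign-*-δ₁ : ∀ n → sign n ℚ.* δ₁ n ≡ ℚ.- δ₁ n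
sign-*-δ₁ 0             = refl
sign-*-δ₁ 1             = refl
sign-*-δ₁ (suc (suc n)) = ℚ.*-zeroʳ (sign (suc (suc n)))

[1+n]Cn≡1+n : ∀ n → suc n C n ≡ suc n
[1+n]Cn≡1+n n = begin
  suc n C n                ≡⟨ nCk≡nC[n∸k] (ℕ.n≤1+n n) ⟩
  suc n C (suc n ∸ n)      ≡⟨ cong (suc n C_) (ℕ.m+n∸n≡m 1 n) ⟩
  suc n C 1                ≡⟨ nC1≡n (suc n) ⟩
  suc n ∎
  where open ≡-Reasoning

⟦C⟧-pascal : ∀ n k → ⟦ suc n C suc k ⟧ ≡ ⟦ n C k ⟧ ℚ.+ ⟦ n C suc k ⟧
⟦C⟧-pascal n k = trans (cong ⟦_⟧ (sym (nCk+nC[k+1]≡[n+1]C[k+1] n k))) (⟦+⟧ (n C k) (n C suc k))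

⟦C⟧-vanish : ∀ {n k} → n < k → ⟦ n C k ⟧ ≡ 0ℚ
⟦C⟧-vanish n<k = cong ⟦_⟧ (k>n⇒nCk≡0 n<k)

[k+l]Ck≡[k+l]Cl : ∀ k l → (k + l) C k ≡ (k + l) C l
[k+l]Ck≡[k+l]Cl k l = trans (nCk≡nC[n∸k] (ℕ.m≤m+n k l)) (cong ((k + l) C_) (ℕ.m+n∸m≡n k l))

[k+l]Ck*k!*l!≡[k+l]! : ∀ k l → ((k + l) C k) * (k ! * l !) ≡ (k + l) !
[k+l]Ck*k!*l!≡[k+l]! k l = begin
  ((k + l) C k) * (k ! * l !)
    ≡⟨ cong (λ m → ((k + l) C k) * (k ! * m !)) (ℕ.m+n∸m≡n k l) ⟨
  ((k + l) C k) * (k ! * (k + l ∸ k) !)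
    ≡⟨ cong (ℕ._* (k ! * (k + l ∸ k) !)) (nCk≡n!/k![n-k]! k≤k+l) ⟩
  ((k + l) ! ℕ./ (k ! * (k + l ∸ k) !)) * (k ! * (k + l ∸ k) !)
    ≡⟨ m/n*n≡m (k![n∸k]!∣n! k≤k+l) ⟩
  (k + l) ! ∎
  where
  open ≡-Reasoning
  k≤k+l = ℕ.m≤m+n k l
  instance _ = ℕ._!*_!≢0 k (k + l ∸ k)

-- Trinomial revision: both sides are (j + p + b)! / (j! p! b!).
C*C-revision : ∀ j p b → ((j + (p + b)) C (j + p)) * ((j + p) C j) ≡ ((j + (p + b)) C j) * ((p + b) C p)
C*C-revision j p b = ℕ.*-cancelʳ-≡ _ _ (j ! * p ! * b !) {{j!p!b!≢0}} (trans lhs (sym rhs))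
  where
  open ≡-Reasoning
  n = j + (p + b)
  j!p!b!≢0 : ℕ.NonZero (j ! * p ! * b !)
  j!p!b!≢0 = ℕ.m*n≢0 (j ! * p !) (b !) {{ℕ._!*_!≢0 j p}} {{ℕ._!≢0 b}}
  regroupˡ : ∀ x y u v w → (x * y) * (u * v * w) ≡ x * ((y * (u * v)) * w)
  regroupˡ = solve-ℕ
  regroupʳ : ∀ x y u v w → (x * y) * (u * v * w) ≡ x * (u * (y * (v * w)))
  regroupʳ = solve-ℕ
  lhs : ((n C (j + p)) * ((j + p) C j)) * (j ! * p ! * b !) ≡ n !
  lhs = begin
    ((n C (j + p)) * ((j + p) C j)) * (j ! * p ! * b !)
      ≡⟨ regroupˡ (n C (j + p)) ((j + p) C j) (j !) (p !) (b !) ⟩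
    (n C (j + p)) * ((((j + p) C j) * (j ! * p !)) * b !)
      ≡⟨ cong (λ m → (n C (j + p)) * (m * b !)) ([k+l]Ck*k!*l!≡[k+l]! j p) ⟩
    (n C (j + p)) * ((j + p) ! * b !)
      ≡⟨ cong (λ m → (m C (j + p)) * ((j + p) ! * b !)) (ℕ.+-assoc j p b) ⟨
    (((j + p) + b) C (j + p)) * ((j + p) ! * b !)
      ≡⟨ [k+l]Ck*k!*l!≡[k+l]! (j + p) b ⟩
    ((j + p) + b) !
      ≡⟨ cong _! (ℕ.+-assoc j p b) ⟩
    n ! ∎
  rhs : ((n C j) * ((p + b) C p)) * (j ! * p ! * b !) ≡ n !
  rhs = begin
    ((n C j) * ((p + b) C p)) * (j ! * p ! * b !)
      ≡⟨ regroupʳ (n C j) ((p + b) C p) (j !) (p !) (b !) ⟩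
    (n C j) * (j ! * (((p + b) C p) * (p ! * b !)))
      ≡⟨ cong (λ m → (n C j) * (j ! * m)) ([k+l]Ck*k!*l!≡[k+l]! p b) ⟩
    (n C j) * (j ! * (p + b) !)
      ≡⟨ [k+l]Ck*k!*l!≡[k+l]! j (p + b) ⟩
    n ! ∎

C*C-revision′ : ∀ j {p d} → p ≤ d → ((j + d) C (j + p)) * ((j + p) C j) ≡ ((j + d) C j) * (d C p)
C*C-revision′ j p≤d with ℕ.m≤n⇒∃[o]m+o≡n p≤d
... | b , refl = C*C-revision j _ b

[l+p+r]C[l+p]*[l+p]Cl≡[l+r]Cl*[l+r+p]Cp : ∀ l p r →
  (((l + p) + r) C (l + p)) * ((l + p) C l) ≡ ((l + r) C l) * (((l + r) + p) C p)
[l+p+r]C[l+p]*[l+p]Cl≡[l+r]Cl*[l+r+p]Cp l p r = begin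
  (((l + p) + r) C (l + p)) * ((l + p) C l) ≡⟨ cong (λ n → (n C (l + p)) * ((l + p) C l)) (ℕ.+-assoc l p r) ⟩
  ((l + (p + r)) C (l + p)) * ((l + p) C l) ≡⟨ C*C-revision l p r ⟩
  ((l + (p + r)) C l) * ((p + r) C p)       ≡⟨ cong (((l + (p + r)) C l) *_) ([k+l]Ck≡[k+l]Cl p r) ⟩
  ((l + (p + r)) C l) * ((p + r) C r)       ≡⟨ cong (λ n → ((l + n) C l) * (n C r)) (ℕ.+-comm p r) ⟩
  ((l + (r + p)) C l) * ((r + p) C r)       ≡⟨ C*C-revision l r p ⟨
  ((l + (r + p)) C (l + r)) * ((l + r) C l) ≡⟨ ℕ.*-comm ((l + (r + p)) C (l + r)) ((l + r) C l) ⟩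
  ((l + r) C l) * ((l + (r + p)) C (l + r)) ≡⟨ cong (λ n → ((l + r) C l) * (n C (l + r))) (ℕ.+-assoc l r p) ⟨
  ((l + r) C l) * (((l + r) + p) C (l + r)) ≡⟨ cong (((l + r) C l) *_) ([k+l]Ck≡[k+l]Cl (l + r) p) ⟩
  ((l + r) C l) * (((l + r) + p) C p) ∎
  where open ≡-Reasoning

-- Vandermonde's convolution for the negative upper index −(q + 1), written with
-- C(−q − 1, p) = (−1)^p C(q + p, p) and C(a − q − 1, M) = (−1)^M C(b, M).
negative-vandermonde : ∀ a M b q → a + b ≡ M + q →
  ∑< (suc M) (λ p → sign p ℚ.* ⟦ a C (M ∸ p) ⟧ ℚ.* ⟦ (q + p) C p ⟧)
    ≡ sign M ℚ.* ⟦ b C M ⟧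
negative-vandermonde zero M b q refl = begin
  ∑< (suc M) (λ p → sign p ℚ.* ⟦ 0 C (M ∸ p) ⟧ ℚ.* ⟦ (q + p) C p ⟧)
    ≡⟨ ∑<-last M (λ p → sign p ℚ.* ⟦ 0 C (M ∸ p) ⟧ ℚ.* ⟦ (q + p) C p ⟧) below ⟩
  sign M ℚ.* ⟦ 0 C (M ∸ M) ⟧ ℚ.* ⟦ (q + M) C M ⟧
    ≡⟨ cong (λ k → sign M ℚ.* ⟦ 0 C k ⟧ ℚ.* ⟦ (q + M) C M ⟧) (ℕ.n∸n≡0 M) ⟩
  sign M ℚ.* 1ℚ ℚ.* ⟦ (q + M) C M ⟧
    ≡⟨ cong₂ ℚ._*_ (ℚ.*-identityʳ (sign M)) (cong (λ n → ⟦ n C M ⟧) (ℕ.+-comm q M)) ⟩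
  sign M ℚ.* ⟦ (M + q) C M ⟧ ∎
  where
  open ≡-Reasoning
  below : ∀ p → p < M → sign p ℚ.* ⟦ 0 C (M ∸ p) ⟧ ℚ.* ⟦ (q + p) C p ⟧ ≡ 0ℚ
  below p p<M = begin
    sign p ℚ.* ⟦ 0 C (M ∸ p) ⟧ ℚ.* ⟦ (q + p) C p ⟧
      ≡⟨ cong (λ c → sign p ℚ.* c ℚ.* ⟦ (q + p) C p ⟧) (⟦C⟧-vanish (ℕ.m<n⇒0<n∸m p<M)) ⟩
    sign p ℚ.* 0ℚ ℚ.* ⟦ (q + p) C p ⟧
      ≡⟨ cong (ℚ._* ⟦ (q + p) C p ⟧) (ℚ.*-zeroʳ (sign p)) ⟩
    0ℚ ℚ.* ⟦ (q + p) C p ⟧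
      ≡⟨ ℚ.*-zeroˡ ⟦ (q + p) C p ⟧ ⟩
    0ℚ ∎
negative-vandermonde (suc a) zero    b q eq = refl
negative-vandermonde (suc a) (suc M) b q eq = begin
  ∑< (suc M) (t (suc a) (suc M)) ℚ.+ t (suc a) (suc M) (suc M)
    ≡⟨ cong₂ ℚ._+_ (trans (∑<-cong (suc M) pascal) (∑<-+ (suc M) (t a M) (t a (suc M)))) last ⟩
  (∑< (suc M) (t a M) ℚ.+ ∑< (suc M) (t a (suc M))) ℚ.+ t a (suc M) (suc M)
    ≡⟨ ℚ.+-assoc (∑< (suc M) (t a M)) (∑< (suc M) (t a (suc M))) (t a (suc M) (suc M)) ⟩
  ∑< (suc M) (t a M) ℚ.+ ∑< (suc (suc M)) (t a (suc M))
    ≡⟨ cong₂ ℚ._+_ (negative-vandermonde a M b q (ℕ.suc-injective eq))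
                   (negative-vandermonde a (suc M) (suc b) q (trans (ℕ.+-suc a b) eq)) ⟩
  sign M ℚ.* ⟦ b C M ⟧ ℚ.+ ℚ.- sign M ℚ.* ⟦ suc b C suc M ⟧
    ≡⟨ cong (λ c → sign M ℚ.* ⟦ b C M ⟧ ℚ.+ ℚ.- sign M ℚ.* c) (⟦C⟧-pascal b M) ⟩
  sign M ℚ.* ⟦ b C M ⟧ ℚ.+ ℚ.- sign M ℚ.* (⟦ b C M ⟧ ℚ.+ ⟦ b C suc M ⟧)
    ≡⟨ cancel (sign M) ⟦ b C M ⟧ ⟦ b C suc M ⟧ ⟩
  ℚ.- sign M ℚ.* ⟦ b C suc M ⟧ ∎
  where
  open ≡-Reasoning
  t : ℕ → ℕ → ℕ → ℚ
  t x m p = sign p ℚ.* ⟦ x C (m ∸ p) ⟧ ℚ.* ⟦ (q + p) C p ⟧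
  distrib : ∀ (s x y c : ℚ) → s ℚ.* (x ℚ.+ y) ℚ.* c ≡ s ℚ.* x ℚ.* c ℚ.+ s ℚ.* y ℚ.* c
  distrib = solve-∀ ℚ-ring
  cancel : ∀ (s x y : ℚ) → s ℚ.* x ℚ.+ ℚ.- s ℚ.* (x ℚ.+ y) ≡ ℚ.- s ℚ.* y
  cancel = solve-∀ ℚ-ring
  pascal : ∀ p → p < suc M → t (suc a) (suc M) p ≡ t a M p ℚ.+ t a (suc M) p
  pascal p p<1+M = begin
    sign p ℚ.* ⟦ suc a C (suc M ∸ p) ⟧ ℚ.* c
      ≡⟨ cong (λ k → sign p ℚ.* ⟦ suc a C k ⟧ ℚ.* c) 1+M∸p≡1+[M∸p] ⟩
    sign p ℚ.* ⟦ suc a C suc (M ∸ p) ⟧ ℚ.* c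
      ≡⟨ cong (λ k → sign p ℚ.* k ℚ.* c) (⟦C⟧-pascal a (M ∸ p)) ⟩
    sign p ℚ.* (⟦ a C (M ∸ p) ⟧ ℚ.+ ⟦ a C suc (M ∸ p) ⟧) ℚ.* c
      ≡⟨ distrib (sign p) ⟦ a C (M ∸ p) ⟧ ⟦ a C suc (M ∸ p) ⟧ c ⟩
    t a M p ℚ.+ sign p ℚ.* ⟦ a C suc (M ∸ p) ⟧ ℚ.* c
      ≡⟨ cong (λ k → t a M p ℚ.+ sign p ℚ.* ⟦ a C k ⟧ ℚ.* c) 1+M∸p≡1+[M∸p] ⟨
    t a M p ℚ.+ t a (suc M) p ∎
    where
    c = ⟦ (q + p) C p ⟧
    1+M∸p≡1+[M∸p] : suc M ∸ p ≡ suc (M ∸ p)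
    1+M∸p≡1+[M∸p] = ℕ.+-∸-assoc 1 (ℕ.m<1+n⇒m≤n p<1+M)
  last : t (suc a) (suc M) (suc M) ≡ t a (suc M) (suc M)
  last = cong (λ k → sign (suc M) ℚ.* ⟦ k ⟧ ℚ.* ⟦ (q + suc M) C suc M ⟧)
              (trans (cong (suc a C_) (ℕ.n∸n≡0 M)) (cong (a C_) (sym (ℕ.n∸n≡0 M))))

alternating-binomial-sum : ∀ {d} → 0 < d → ∑< (suc d) (λ p → ⟦ d C p ⟧ ℚ.* sign p) ≡ 0ℚ
alternating-binomial-sum {suc d} _ = begin
  ∑< (suc (suc d)) (λ p → ⟦ suc d C p ⟧ ℚ.* sign p)
    ≡⟨ ∑<-cong (suc (suc d)) (λ p p<2+d → as-vandermonde p (ℕ.m<1+n⇒m≤n p<2+d)) ⟩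
  ∑< (suc (suc d)) (λ p → sign p ℚ.* ⟦ suc d C (suc d ∸ p) ⟧ ℚ.* ⟦ p C p ⟧)
    ≡⟨ negative-vandermonde (suc d) (suc d) 0 0 refl ⟩
  sign (suc d) ℚ.* 0ℚ
    ≡⟨ ℚ.*-zeroʳ (sign (suc d)) ⟩
  0ℚ ∎
  where
  open ≡-Reasoning
  as-vandermonde : ∀ p → p ≤ suc d →
    ⟦ suc d C p ⟧ ℚ.* sign p ≡ sign p ℚ.* ⟦ suc d C (suc d ∸ p) ⟧ ℚ.* ⟦ p C p ⟧
  as-vandermonde p p≤1+d = begin
    ⟦ suc d C p ⟧ ℚ.* sign p
      ≡⟨ ℚ.*-comm ⟦ suc d C p ⟧ (sign p) ⟩
    sign p ℚ.* ⟦ suc d C p ⟧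
      ≡⟨ cong (λ k → sign p ℚ.* ⟦ k ⟧) (nCk≡nC[n∸k] p≤1+d) ⟩
    sign p ℚ.* ⟦ suc d C (suc d ∸ p) ⟧
      ≡⟨ ℚ.*-identityʳ _ ⟨
    sign p ℚ.* ⟦ suc d C (suc d ∸ p) ⟧ ℚ.* 1ℚ
      ≡⟨ cong (λ k → sign p ℚ.* ⟦ suc d C (suc d ∸ p) ⟧ ℚ.* ⟦ k ⟧) (nCn≡1 p) ⟨
    sign p ℚ.* ⟦ suc d C (suc d ∸ p) ⟧ ℚ.* ⟦ p C p ⟧ ∎

∑<-C-sign-C′ : ∀ j d →
  ∑< (suc (j + d)) (λ l → ⟦ (j + d) C l ⟧ ℚ.* sign l ℚ.* ⟦ l C j ⟧)
    ≡ ⟦ (j + d) C j ⟧ ℚ.* sign j ℚ.* ∑< (suc d) (λ p → ⟦ d C p ⟧ ℚ.* sign p)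
∑<-C-sign-C′ j d = begin
  ∑< (suc (j + d)) (λ l → ⟦ (j + d) C l ⟧ ℚ.* sign l ℚ.* ⟦ l C j ⟧)
    ≡⟨ cong (λ k → ∑< k (λ l → ⟦ (j + d) C l ⟧ ℚ.* sign l ℚ.* ⟦ l C j ⟧)) (ℕ.+-suc j d) ⟨
  ∑< (j + suc d) (λ l → ⟦ (j + d) C l ⟧ ℚ.* sign l ℚ.* ⟦ l C j ⟧)
    ≡⟨ ∑<-drop j (suc d) (λ l → ⟦ (j + d) C l ⟧ ℚ.* sign l ℚ.* ⟦ l C j ⟧) below ⟩
  ∑< (suc d) (λ p → ⟦ (j + d) C (j + p) ⟧ ℚ.* sign (j + p) ℚ.* ⟦ (j + p) C j ⟧)
    ≡⟨ ∑<-cong (suc d) (λ p p<1+d → shifted p (ℕ.m<1+n⇒m≤n p<1+d)) ⟩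
  ∑< (suc d) (λ p → ⟦ (j + d) C j ⟧ ℚ.* sign j ℚ.* (⟦ d C p ⟧ ℚ.* sign p))
    ≡⟨ ∑<-*ˡ (suc d) (⟦ (j + d) C j ⟧ ℚ.* sign j) (λ p → ⟦ d C p ⟧ ℚ.* sign p) ⟨
  ⟦ (j + d) C j ⟧ ℚ.* sign j ℚ.* ∑< (suc d) (λ p → ⟦ d C p ⟧ ℚ.* sign p) ∎
  where
  open ≡-Reasoning
  below : ∀ l → l < j → ⟦ (j + d) C l ⟧ ℚ.* sign l ℚ.* ⟦ l C j ⟧ ≡ 0ℚ
  below l l<j = trans (cong (x ℚ.*_) (⟦C⟧-vanish l<j)) (ℚ.*-zeroʳ x)
    where x = ⟦ (j + d) C l ⟧ ℚ.* sign l
  regroup : ∀ (x y s t : ℚ) → x ℚ.* (s ℚ.* t) ℚ.* y ≡ (x ℚ.* y) ℚ.* (s ℚ.* t)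
  regroup = solve-∀ ℚ-ring
  regroup′ : ∀ (u v s t : ℚ) → (u ℚ.* v) ℚ.* (s ℚ.* t) ≡ u ℚ.* s ℚ.* (v ℚ.* t)
  regroup′ = solve-∀ ℚ-ring
  shifted : ∀ p → p ≤ d → ⟦ (j + d) C (j + p) ⟧ ℚ.* sign (j + p) ℚ.* ⟦ (j + p) C j ⟧
                           ≡ ⟦ (j + d) C j ⟧ ℚ.* sign j ℚ.* (⟦ d C p ⟧ ℚ.* sign p)
  shifted p p≤d = begin
    ⟦ (j + d) C (j + p) ⟧ ℚ.* sign (j + p) ℚ.* ⟦ (j + p) C j ⟧
      ≡⟨ cong (λ s → ⟦ (j + d) C (j + p) ⟧ ℚ.* s ℚ.* ⟦ (j + p) C j ⟧) (sign-+ j p) ⟩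
    ⟦ (j + d) C (j + p) ⟧ ℚ.* (sign j ℚ.* sign p) ℚ.* ⟦ (j + p) C j ⟧
      ≡⟨ regroup ⟦ (j + d) C (j + p) ⟧ ⟦ (j + p) C j ⟧ (sign j) (sign p) ⟩
    (⟦ (j + d) C (j + p) ⟧ ℚ.* ⟦ (j + p) C j ⟧) ℚ.* (sign j ℚ.* sign p)
      ≡⟨ cong (ℚ._* (sign j ℚ.* sign p))
              (⟦⟧*⟦⟧-cong {(j + d) C (j + p)} {(j + p) C j} {(j + d) C j} {d C p}
                          (C*C-revision′ j p≤d)) ⟩
    (⟦ (j + d) C j ⟧ ℚ.* ⟦ d C p ⟧) ℚ.* (sign j ℚ.* sign p)
      ≡⟨ regroup′ ⟦ (j + d) C j ⟧ ⟦ d C p ⟧ (sign j) (sign p) ⟩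
    ⟦ (j + d) C j ⟧ ℚ.* sign j ℚ.* (⟦ d C p ⟧ ℚ.* sign p) ∎

∑<-C-sign-C : ∀ {j n} → j ≤ n →
  ∑< (suc n) (λ l → ⟦ n C l ⟧ ℚ.* sign l ℚ.* ⟦ l C j ⟧)
    ≡ ⟦ n C j ⟧ ℚ.* sign j ℚ.* ∑< (suc (n ∸ j)) (λ p → ⟦ (n ∸ j) C p ⟧ ℚ.* sign p)
∑<-C-sign-C {j} {n} j≤n =
  subst (λ e → ∑< (suc e) (λ l → ⟦ e C l ⟧ ℚ.* sign l ℚ.* ⟦ l C j ⟧)
                 ≡ ⟦ e C j ⟧ ℚ.* sign j ℚ.* ∑< (suc (n ∸ j)) (λ p → ⟦ (n ∸ j) C p ⟧ ℚ.* sign p))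
        (ℕ.m+[n∸m]≡n j≤n) (∑<-C-sign-C′ j (n ∸ j))

∑<-C-sign-C≡0 : ∀ {j n} → j < n →
  ∑< (suc n) (λ l → ⟦ n C l ⟧ ℚ.* sign l ℚ.* ⟦ l C j ⟧) ≡ 0ℚ
∑<-C-sign-C≡0 {j} {n} j<n = begin
  ∑< (suc n) (λ l → ⟦ n C l ⟧ ℚ.* sign l ℚ.* ⟦ l C j ⟧)
    ≡⟨ ∑<-C-sign-C {j} {n} (ℕ.<⇒≤ j<n) ⟩
  ⟦ n C j ⟧ ℚ.* sign j ℚ.* ∑< (suc (n ∸ j)) (λ p → ⟦ (n ∸ j) C p ⟧ ℚ.* sign p)
    ≡⟨ cong (⟦ n C j ⟧ ℚ.* sign j ℚ.*_) (alternating-binomial-sum (ℕ.m<n⇒0<n∸m j<n)) ⟩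
  ⟦ n C j ⟧ ℚ.* sign j ℚ.* 0ℚ
    ≡⟨ ℚ.*-zeroʳ (⟦ n C j ⟧ ℚ.* sign j) ⟩
  0ℚ ∎
  where open ≡-Reasoning

∑<-C-sign-C≡sign : ∀ n → ∑< (suc n) (λ l → ⟦ n C l ⟧ ℚ.* sign l ℚ.* ⟦ l C n ⟧) ≡ sign n
∑<-C-sign-C≡sign n = begin
  ∑< (suc n) (λ l → ⟦ n C l ⟧ ℚ.* sign l ℚ.* ⟦ l C n ⟧)
    ≡⟨ ∑<-C-sign-C {n} {n} ℕ.≤-refl ⟩
  ⟦ n C n ⟧ ℚ.* sign n ℚ.* ∑< (suc (n ∸ n)) (λ p → ⟦ (n ∸ n) C p ⟧ ℚ.* sign p)
    ≡⟨ cong₂ (λ c e → ⟦ c ⟧ ℚ.* sign n ℚ.* ∑< (suc e) (λ p → ⟦ e C p ⟧ ℚ.* sign p))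
             (nCn≡1 n) (ℕ.n∸n≡0 n) ⟩
  1ℚ ℚ.* sign n ℚ.* 1ℚ
    ≡⟨ trans (ℚ.*-identityʳ (1ℚ ℚ.* sign n)) (ℚ.*-identityˡ (sign n)) ⟩
  sign n ∎
  where open ≡-Reasoning

binomial : (ℕ → ℚ) → ℕ → ℚ
binomial f n = ∑< (suc n) (λ l → ⟦ n C l ⟧ ℚ.* f l)

alternate : (ℕ → ℚ) → ℕ → ℚ
alternate f n = sign n ℚ.* f n

binomial-extend : ∀ f {l n} → l ≤ n → binomial f l ≡ ∑< (suc n) (λ j → ⟦ l C j ⟧ ℚ.* f j)
binomial-extend f {l} l≤n = sym (∑<-trim (λ j → ⟦ l C j ⟧ ℚ.* f j) (s≤s l≤n) above)
  where
  above : ∀ p → ⟦ l C (suc l + p) ⟧ ℚ.* f (suc l + p) ≡ 0ℚ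
  above p = trans (cong (ℚ._* f (suc l + p)) (⟦C⟧-vanish (ℕ.m≤m+n (suc l) p)))
                  (ℚ.*-zeroˡ (f (suc l + p)))

binomial-cong : ∀ {f g} → (∀ l → f l ≡ g l) → ∀ n → binomial f n ≡ binomial g n
binomial-cong f≗g n = ∑<-cong (suc n) (λ l _ → cong (⟦ n C l ⟧ ℚ.*_) (f≗g l))

binomial-difference : ∀ f g n →
  binomial (λ l → f l ℚ.+ ℚ.- g l) n ≡ binomial f n ℚ.+ ℚ.- binomial g n
binomial-difference f g n = begin
  ∑< (suc n) (λ l → ⟦ n C l ⟧ ℚ.* (f l ℚ.+ ℚ.- g l))
    ≡⟨ ∑<-cong (suc n) (λ l _ → distrib ⟦ n C l ⟧ (f l) (g l)) ⟩
  ∑< (suc n) (λ l → ⟦ n C l ⟧ ℚ.* f l ℚ.+ ℚ.- (⟦ n C l ⟧ ℚ.* g l))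
    ≡⟨ ∑<-+ (suc n) (λ l → ⟦ n C l ⟧ ℚ.* f l) (λ l → ℚ.- (⟦ n C l ⟧ ℚ.* g l)) ⟩
  binomial f n ℚ.+ ∑< (suc n) (λ l → ℚ.- (⟦ n C l ⟧ ℚ.* g l))
    ≡⟨ cong (binomial f n ℚ.+_) (∑<-neg (suc n) (λ l → ⟦ n C l ⟧ ℚ.* g l)) ⟩
  binomial f n ℚ.+ ℚ.- binomial g n ∎
  where
  open ≡-Reasoning
  distrib : ∀ (c x y : ℚ) → c ℚ.* (x ℚ.+ ℚ.- y) ≡ c ℚ.* x ℚ.+ ℚ.- (c ℚ.* y)
  distrib = solve-∀ ℚ-ring

binomial-inversion : ∀ f n → binomial (alternate (binomial f)) n ≡ alternate f n
binomial-inversion f n = begin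
  binomial (alternate (binomial f)) n
    ≡⟨ ∑<-cong (suc n) (λ l l<1+n → expand l (ℕ.m<1+n⇒m≤n l<1+n)) ⟩
  ∑< (suc n) (λ l → ∑< (suc n) (λ j → (⟦ n C l ⟧ ℚ.* sign l) ℚ.* (⟦ l C j ⟧ ℚ.* f j)))
    ≡⟨ ∑<-swap (suc n) (suc n) (λ l j → (⟦ n C l ⟧ ℚ.* sign l) ℚ.* (⟦ l C j ⟧ ℚ.* f j)) ⟩
  ∑< (suc n) (λ j → ∑< (suc n) (λ l → (⟦ n C l ⟧ ℚ.* sign l) ℚ.* (⟦ l C j ⟧ ℚ.* f j)))
    ≡⟨ ∑<-cong (suc n) (λ j _ → factor j) ⟩
  ∑< (suc n) (λ j → kernel j ℚ.* f j)
    ≡⟨ ∑<-last n (λ j → kernel j ℚ.* f j)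
                (λ j j<n → trans (cong (ℚ._* f j) (∑<-C-sign-C≡0 j<n)) (ℚ.*-zeroˡ (f j))) ⟩
  kernel n ℚ.* f n
    ≡⟨ cong (ℚ._* f n) (∑<-C-sign-C≡sign n) ⟩
  sign n ℚ.* f n ∎
  where
  open ≡-Reasoning
  kernel : ℕ → ℚ
  kernel j = ∑< (suc n) (λ l → ⟦ n C l ⟧ ℚ.* sign l ℚ.* ⟦ l C j ⟧)
  expand : ∀ l → l ≤ n → ⟦ n C l ⟧ ℚ.* (sign l ℚ.* binomial f l)
                        ≡ ∑< (suc n) (λ j → (⟦ n C l ⟧ ℚ.* sign l) ℚ.* (⟦ l C j ⟧ ℚ.* f j))
  expand l l≤n = begin
    ⟦ n C l ⟧ ℚ.* (sign l ℚ.* binomial f l)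
      ≡⟨ ℚ.*-assoc ⟦ n C l ⟧ (sign l) (binomial f l) ⟨
    (⟦ n C l ⟧ ℚ.* sign l) ℚ.* binomial f l
      ≡⟨ cong ((⟦ n C l ⟧ ℚ.* sign l) ℚ.*_) (binomial-extend f l≤n) ⟩
    (⟦ n C l ⟧ ℚ.* sign l) ℚ.* ∑< (suc n) (λ j → ⟦ l C j ⟧ ℚ.* f j)
      ≡⟨ ∑<-*ˡ (suc n) (⟦ n C l ⟧ ℚ.* sign l) (λ j → ⟦ l C j ⟧ ℚ.* f j) ⟩
    ∑< (suc n) (λ j → (⟦ n C l ⟧ ℚ.* sign l) ℚ.* (⟦ l C j ⟧ ℚ.* f j)) ∎
  factor : ∀ j →
    ∑< (suc n) (λ l → (⟦ n C l ⟧ ℚ.* sign l) ℚ.* (⟦ l C j ⟧ ℚ.* f j)) ≡ kernel j ℚ.* f j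
  factor j =
    trans (∑<-cong (suc n) (λ l _ → sym (ℚ.*-assoc (⟦ n C l ⟧ ℚ.* sign l) ⟦ l C j ⟧ (f j))))
          (sym (∑<-*ʳ (suc n) (f j) (λ l → ⟦ n C l ⟧ ℚ.* sign l ℚ.* ⟦ l C j ⟧)))

binomial-fixed⇒zero : ∀ f → (∀ n → binomial f n ≡ f n) → ∀ n → f n ≡ 0ℚ
binomial-fixed⇒zero f fixed = <-rec (λ n → f n ≡ 0ℚ) vanishes
  where
  x+1*y≡y⇒x≡0 : ∀ (x y : ℚ) → x ℚ.+ 1ℚ ℚ.* y ≡ y → x ≡ 0ℚ
  x+1*y≡y⇒x≡0 x y eq = trans (unfold x y) (trans (cong (ℚ._+ ℚ.- y) eq) (ℚ.+-inverseʳ y))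
    where
    unfold : ∀ (x y : ℚ) → x ≡ (x ℚ.+ 1ℚ ℚ.* y) ℚ.+ ℚ.- y
    unfold = solve-∀ ℚ-ring
  -- In binomial f (m + 1) = f (m + 1) the only other surviving term is (m + 1) f m.
  vanishes : ∀ m → (∀ {l} → l < m → f l ≡ 0ℚ) → f m ≡ 0ℚ
  vanishes m below = ⟦suc⟧*x≡0⇒x≡0 m (f m) (begin
    ⟦ suc m ⟧ ℚ.* f m
      ≡⟨ cong (λ c → ⟦ c ⟧ ℚ.* f m) ([1+n]Cn≡1+n m) ⟨
    ⟦ suc m C m ⟧ ℚ.* f m
      ≡⟨ ∑<-last m g (λ l l<m → trans (cong (⟦ suc m C l ⟧ ℚ.*_) (below l<m)) (ℚ.*-zeroʳ ⟦ suc m C l ⟧)) ⟨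
    ∑< (suc m) g
      ≡⟨ x+1*y≡y⇒x≡0 (∑< (suc m) g) (f (suc m))
           (trans (cong (λ c → ∑< (suc m) g ℚ.+ ⟦ c ⟧ ℚ.* f (suc m)) (sym (nCn≡1 (suc m)))) (fixed (suc m))) ⟩
    0ℚ ∎)
    where
    open ≡-Reasoning
    g : ℕ → ℚ
    g l = ⟦ suc m C l ⟧ ℚ.* f l

-- The defect alternate f − binomial f is a fixed point of the binomial transform.
binomial≡alternate : ∀ f → (∀ n → binomial f n ≡ f n ℚ.+ δ₁ n) →
                     ∀ n → binomial f n ≡ alternate f n
binomial≡alternate f recurrence n =
  sym (x+-y≡0⇒x≡y (alternate f n) (binomial f n) (binomial-fixed⇒zero defect defect-fixed n))
  where
  open ≡-Reasoning
  x+-y≡0⇒x≡y : ∀ (x y : ℚ) → x ℚ.+ ℚ.- y ≡ 0ℚ → x ≡ y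
  x+-y≡0⇒x≡y x y eq = trans (unfold x y) (trans (cong (ℚ._+ y) eq) (ℚ.+-identityˡ y))
    where
    unfold : ∀ (x y : ℚ) → x ≡ (x ℚ.+ ℚ.- y) ℚ.+ y
    unfold = solve-∀ ℚ-ring
  defect : ℕ → ℚ
  defect l = alternate f l ℚ.+ ℚ.- binomial f l
  shuffle : ∀ (s x d : ℚ) → s ℚ.* x ℚ.+ ℚ.- (x ℚ.+ d) ≡ s ℚ.* x ℚ.+ ℚ.- d ℚ.+ ℚ.- x
  shuffle = solve-∀ ℚ-ring
  distrib : ∀ (s x d : ℚ) → s ℚ.* x ℚ.+ s ℚ.* d ℚ.+ ℚ.- x ≡ s ℚ.* (x ℚ.+ d) ℚ.+ ℚ.- x
  distrib = solve-∀ ℚ-ring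
  defect-alternative : ∀ l → defect l ≡ alternate (binomial f) l ℚ.+ ℚ.- f l
  defect-alternative l = begin
    sign l ℚ.* f l ℚ.+ ℚ.- binomial f l
      ≡⟨ cong (λ b → sign l ℚ.* f l ℚ.+ ℚ.- b) (recurrence l) ⟩
    sign l ℚ.* f l ℚ.+ ℚ.- (f l ℚ.+ δ₁ l)
      ≡⟨ shuffle (sign l) (f l) (δ₁ l) ⟩
    sign l ℚ.* f l ℚ.+ ℚ.- δ₁ l ℚ.+ ℚ.- f l
      ≡⟨ cong (λ e → sign l ℚ.* f l ℚ.+ e ℚ.+ ℚ.- f l) (sign-*-δ₁ l) ⟨
    sign l ℚ.* f l ℚ.+ sign l ℚ.* δ₁ l ℚ.+ ℚ.- f l
      ≡⟨ distrib (sign l) (f l) (δ₁ l) ⟩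
    sign l ℚ.* (f l ℚ.+ δ₁ l) ℚ.+ ℚ.- f l
      ≡⟨ cong (λ b → sign l ℚ.* b ℚ.+ ℚ.- f l) (recurrence l) ⟨
    sign l ℚ.* binomial f l ℚ.+ ℚ.- f l ∎
  defect-fixed : ∀ n → binomial defect n ≡ defect n
  defect-fixed n = begin
    binomial defect n
      ≡⟨ binomial-cong defect-alternative n ⟩
    binomial (λ l → alternate (binomial f) l ℚ.+ ℚ.- f l) n
      ≡⟨ binomial-difference (alternate (binomial f)) f n ⟩
    binomial (alternate (binomial f)) n ℚ.+ ℚ.- binomial f n
      ≡⟨ cong (ℚ._+ ℚ.- binomial f n) (binomial-inversion f n) ⟩
    defect n ∎

foldr-zipWith-revB : ∀ n c →
  foldr ℚ._+_ 0ℚ (zipWith (λ j b → ⟦ c C j ⟧ ℚ.* b) (downFrom n) (revB n))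
    ≡ ∑< n (λ j → ⟦ c C j ⟧ ℚ.* B j)
foldr-zipWith-revB zero    c = refl
foldr-zipWith-revB (suc n) c =
  trans (cong (⟦ c C n ⟧ ℚ.* B n ℚ.+_) (foldr-zipWith-revB n c))
        (ℚ.+-comm (⟦ c C n ⟧ ℚ.* B n) (∑< n (λ j → ⟦ c C j ⟧ ℚ.* B j)))

bernoulli-recurrence : ∀ n → ∑< n (λ j → ⟦ n C j ⟧ ℚ.* B j) ≡ δ₁ n
bernoulli-recurrence 0             = refl
bernoulli-recurrence 1             = refl
bernoulli-recurrence (suc (suc m)) = begin
  S ℚ.+ ⟦ suc (suc m) C suc m ⟧ ℚ.* B (suc m)
    ≡⟨ cong₂ (λ c b → S ℚ.+ ⟦ c ⟧ ℚ.* ℚ.- (c⁻¹ ℚ.* b))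
             ([1+n]Cn≡1+n (suc m)) (foldr-zipWith-revB (suc m) (suc (suc m))) ⟩
  S ℚ.+ ⟦ suc (suc m) ⟧ ℚ.* ℚ.- (c⁻¹ ℚ.* S)
    ≡⟨ regroup S ⟦ suc (suc m) ⟧ c⁻¹ ⟩
  S ℚ.+ ℚ.- ((⟦ suc (suc m) ⟧ ℚ.* c⁻¹) ℚ.* S)
    ≡⟨ cong (λ e → S ℚ.+ ℚ.- (e ℚ.* S)) (⟦suc⟧-inverse (suc m)) ⟩
  S ℚ.+ ℚ.- (1ℚ ℚ.* S)
    ≡⟨ cancel S ⟩
  0ℚ ∎
  where
  open ≡-Reasoning
  S = ∑< (suc m) (λ j → ⟦ suc (suc m) C j ⟧ ℚ.* B j)
  c⁻¹ = + 1 ℚ./ suc (suc m)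
  regroup : ∀ (s c d : ℚ) → s ℚ.+ c ℚ.* ℚ.- (d ℚ.* s) ≡ s ℚ.+ ℚ.- ((c ℚ.* d) ℚ.* s)
  regroup = solve-∀ ℚ-ring
  cancel : ∀ (s : ℚ) → s ℚ.+ ℚ.- (1ℚ ℚ.* s) ≡ 0ℚ
  cancel = solve-∀ ℚ-ring

binomial-B : ∀ n → binomial B n ≡ B n ℚ.+ δ₁ n
binomial-B n = begin
  ∑< n (λ j → ⟦ n C j ⟧ ℚ.* B j) ℚ.+ ⟦ n C n ⟧ ℚ.* B n
    ≡⟨ cong₂ (λ s c → s ℚ.+ ⟦ c ⟧ ℚ.* B n) (bernoulli-recurrence n) (nCn≡1 n) ⟩
  δ₁ n ℚ.+ 1ℚ ℚ.* B n
    ≡⟨ cong (δ₁ n ℚ.+_) (ℚ.*-identityˡ (B n)) ⟩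
  δ₁ n ℚ.+ B n
    ≡⟨ ℚ.+-comm (δ₁ n) (B n) ⟩
  B n ℚ.+ δ₁ n ∎
  where open ≡-Reasoning

B≡sign*binomial-B : ∀ n → B n ≡ sign n ℚ.* binomial B n
B≡sign*binomial-B n = sym (begin
  sign n ℚ.* binomial B n           ≡⟨ cong (sign n ℚ.*_) (binomial≡alternate B binomial-B n) ⟩
  sign n ℚ.* (sign n ℚ.* B n)       ≡⟨ ℚ.*-assoc (sign n) (sign n) (B n) ⟨
  (sign n ℚ.* sign n) ℚ.* B n       ≡⟨ cong (ℚ._* B n) (sign-*-sign n) ⟩
  1ℚ ℚ.* B n                        ≡⟨ ℚ.*-identityˡ (B n) ⟩
  B n ∎)
  where open ≡-Reasoning

∑<-sign-C-C-C′ : ∀ a b l M r → a + b ≡ (l + M) + r →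
  ∑< (suc (l + M)) (λ n → sign n ℚ.* ⟦ a C (l + M ∸ n) ⟧ ℚ.* ⟦ (n + r) C n ⟧ ℚ.* ⟦ n C l ⟧)
    ≡ sign (l + M) ℚ.* ⟦ b C M ⟧ ℚ.* ⟦ (l + r) C l ⟧
∑<-sign-C-C-C′ a b l M r eq = begin
  ∑< (suc (l + M)) w
    ≡⟨ cong (λ k → ∑< k w) (ℕ.+-suc l M) ⟨
  ∑< (l + suc M) w
    ≡⟨ ∑<-drop l (suc M) w below ⟩
  ∑< (suc M) (λ p → w (l + p))
    ≡⟨ ∑<-cong (suc M) (λ p _ → shifted p) ⟩
  ∑< (suc M) (λ p → c ℚ.* v p)
    ≡⟨ ∑<-*ˡ (suc M) c v ⟨
  c ℚ.* ∑< (suc M) v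
    ≡⟨ cong (c ℚ.*_) (negative-vandermonde a M b (l + r) a+b≡M+[l+r]) ⟩
  c ℚ.* (sign M ℚ.* ⟦ b C M ⟧)
    ≡⟨ regroup (sign l) ⟦ (l + r) C l ⟧ (sign M) ⟦ b C M ⟧ ⟩
  sign l ℚ.* sign M ℚ.* ⟦ b C M ⟧ ℚ.* ⟦ (l + r) C l ⟧
    ≡⟨ cong (λ s → s ℚ.* ⟦ b C M ⟧ ℚ.* ⟦ (l + r) C l ⟧) (sign-+ l M) ⟨
  sign (l + M) ℚ.* ⟦ b C M ⟧ ℚ.* ⟦ (l + r) C l ⟧ ∎
  where
  open ≡-Reasoning
  w : ℕ → ℚ
  w n = sign n ℚ.* ⟦ a C (l + M ∸ n) ⟧ ℚ.* ⟦ (n + r) C n ⟧ ℚ.* ⟦ n C l ⟧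
  c = sign l ℚ.* ⟦ (l + r) C l ⟧
  v : ℕ → ℚ
  v p = sign p ℚ.* ⟦ a C (M ∸ p) ⟧ ℚ.* ⟦ ((l + r) + p) C p ⟧
  a+b≡M+[l+r] : a + b ≡ M + (l + r)
  a+b≡M+[l+r] = trans eq (rearrange l M r)
    where
    rearrange : ∀ l M r → l + M + r ≡ M + (l + r)
    rearrange = solve-ℕ
  below : ∀ n → n < l → w n ≡ 0ℚ
  below n n<l = trans (cong (x ℚ.*_) (⟦C⟧-vanish n<l)) (ℚ.*-zeroʳ x)
    where x = sign n ℚ.* ⟦ a C (l + M ∸ n) ⟧ ℚ.* ⟦ (n + r) C n ⟧
  regroup : ∀ (s c t x : ℚ) → (s ℚ.* c) ℚ.* (t ℚ.* x) ≡ s ℚ.* t ℚ.* x ℚ.* c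
  regroup = solve-∀ ℚ-ring
  split-off : ∀ (s t x y z : ℚ) → s ℚ.* t ℚ.* x ℚ.* y ℚ.* z ≡ (s ℚ.* t ℚ.* x) ℚ.* (y ℚ.* z)
  split-off = solve-∀ ℚ-ring
  recombine : ∀ (s t x u z : ℚ) → (s ℚ.* t ℚ.* x) ℚ.* (u ℚ.* z) ≡ (s ℚ.* u) ℚ.* (t ℚ.* x ℚ.* z)
  recombine = solve-∀ ℚ-ring
  shifted : ∀ p → w (l + p) ≡ c ℚ.* v p
  shifted p = begin
    sign (l + p) ℚ.* ⟦ a C (l + M ∸ (l + p)) ⟧ ℚ.* ⟦ (l + p + r) C (l + p) ⟧ ℚ.* ⟦ (l + p) C l ⟧
      ≡⟨ cong₂ (λ s k → s ℚ.* ⟦ a C k ⟧ ℚ.* ⟦ (l + p + r) C (l + p) ⟧ ℚ.* ⟦ (l + p) C l ⟧)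
               (sign-+ l p) (ℕ.[m+n]∸[m+o]≡n∸o l M p) ⟩
    sign l ℚ.* sign p ℚ.* ⟦ a C (M ∸ p) ⟧ ℚ.* ⟦ (l + p + r) C (l + p) ⟧ ℚ.* ⟦ (l + p) C l ⟧
      ≡⟨ split-off (sign l) (sign p) ⟦ a C (M ∸ p) ⟧ ⟦ (l + p + r) C (l + p) ⟧ ⟦ (l + p) C l ⟧ ⟩
    (sign l ℚ.* sign p ℚ.* ⟦ a C (M ∸ p) ⟧) ℚ.* (⟦ (l + p + r) C (l + p) ⟧ ℚ.* ⟦ (l + p) C l ⟧)
      ≡⟨ cong ((sign l ℚ.* sign p ℚ.* ⟦ a C (M ∸ p) ⟧) ℚ.*_)
              (⟦⟧*⟦⟧-cong {(l + p + r) C (l + p)} {(l + p) C l} {(l + r) C l} {(l + r + p) C p}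
                         ([l+p+r]C[l+p]*[l+p]Cl≡[l+r]Cl*[l+r+p]Cp l p r)) ⟩
    (sign l ℚ.* sign p ℚ.* ⟦ a C (M ∸ p) ⟧) ℚ.* (⟦ (l + r) C l ⟧ ℚ.* ⟦ (l + r + p) C p ⟧)
      ≡⟨ recombine (sign l) (sign p) ⟦ a C (M ∸ p) ⟧ ⟦ (l + r) C l ⟧ ⟦ (l + r + p) C p ⟧ ⟩
    c ℚ.* v p ∎

∑<-sign-C-C-C : ∀ a b m r l → l ≤ m → a + b ≡ m + r →
  ∑< (suc m) (λ n → sign n ℚ.* ⟦ a C (m ∸ n) ⟧ ℚ.* ⟦ (n + r) C n ⟧ ℚ.* ⟦ n C l ⟧)
    ≡ sign m ℚ.* ⟦ b C (m ∸ l) ⟧ ℚ.* ⟦ (l + r) C l ⟧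
∑<-sign-C-C-C a b m r l l≤m =
  subst (λ e → a + b ≡ e + r →
                 ∑< (suc e) (λ n → sign n ℚ.* ⟦ a C (e ∸ n) ⟧ ℚ.* ⟦ (n + r) C n ⟧ ℚ.* ⟦ n C l ⟧)
                   ≡ sign e ℚ.* ⟦ b C (m ∸ l) ⟧ ℚ.* ⟦ (l + r) C l ⟧)
        (ℕ.m+[n∸m]≡n l≤m) (∑<-sign-C-C-C′ a b l (m ∸ l) r)

bernoulliSum : ℕ → ℕ → ℕ → ℚ
bernoulliSum a m r = ∑< (suc m) (λ n → ⟦ a C (m ∸ n) ⟧ ℚ.* ⟦ (n + r) C n ⟧ ℚ.* B n)

bernoulliSum-reflect : ∀ a b m r → a + b ≡ m + r →
                       bernoulliSum a m r ≡ sign m ℚ.* bernoulliSum b m r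
bernoulliSum-reflect a b m r eq = begin
  bernoulliSum a m r
    ≡⟨ ∑<-cong (suc m) (λ n n<1+m → expand n (ℕ.m<1+n⇒m≤n n<1+m)) ⟩
  ∑< (suc m) (λ n → ∑< (suc m) (λ l → w n l ℚ.* B l))
    ≡⟨ ∑<-swap (suc m) (suc m) (λ n l → w n l ℚ.* B l) ⟩
  ∑< (suc m) (λ l → ∑< (suc m) (λ n → w n l ℚ.* B l))
    ≡⟨ ∑<-cong (suc m) (λ l l<1+m → collapse l (ℕ.m<1+n⇒m≤n l<1+m)) ⟩
  ∑< (suc m) (λ l → sign m ℚ.* (⟦ b C (m ∸ l) ⟧ ℚ.* ⟦ (l + r) C l ⟧ ℚ.* B l))
    ≡⟨ ∑<-*ˡ (suc m) (sign m) (λ l → ⟦ b C (m ∸ l) ⟧ ℚ.* ⟦ (l + r) C l ⟧ ℚ.* B l) ⟨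
  sign m ℚ.* bernoulliSum b m r ∎
  where
  open ≡-Reasoning
  w : ℕ → ℕ → ℚ
  w n l = sign n ℚ.* ⟦ a C (m ∸ n) ⟧ ℚ.* ⟦ (n + r) C n ⟧ ℚ.* ⟦ n C l ⟧
  regroup : ∀ (x y s t : ℚ) → x ℚ.* y ℚ.* (s ℚ.* t) ≡ (s ℚ.* x ℚ.* y) ℚ.* t
  regroup = solve-∀ ℚ-ring
  regroup′ : ∀ (s x y z : ℚ) → s ℚ.* x ℚ.* y ℚ.* z ≡ s ℚ.* (x ℚ.* y ℚ.* z)
  regroup′ = solve-∀ ℚ-ring
  expand : ∀ n → n ≤ m →
    ⟦ a C (m ∸ n) ⟧ ℚ.* ⟦ (n + r) C n ⟧ ℚ.* B n ≡ ∑< (suc m) (λ l → w n l ℚ.* B l)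
  expand n n≤m = begin
    x ℚ.* y ℚ.* B n
      ≡⟨ cong (x ℚ.* y ℚ.*_) (B≡sign*binomial-B n) ⟩
    x ℚ.* y ℚ.* (sign n ℚ.* binomial B n)
      ≡⟨ regroup x y (sign n) (binomial B n) ⟩
    (sign n ℚ.* x ℚ.* y) ℚ.* binomial B n
      ≡⟨ cong ((sign n ℚ.* x ℚ.* y) ℚ.*_) (binomial-extend B n≤m) ⟩
    (sign n ℚ.* x ℚ.* y) ℚ.* ∑< (suc m) (λ l → ⟦ n C l ⟧ ℚ.* B l)
      ≡⟨ ∑<-*ˡ (suc m) (sign n ℚ.* x ℚ.* y) (λ l → ⟦ n C l ⟧ ℚ.* B l) ⟩
    ∑< (suc m) (λ l → (sign n ℚ.* x ℚ.* y) ℚ.* (⟦ n C l ⟧ ℚ.* B l))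
      ≡⟨ ∑<-cong (suc m) (λ l _ → sym (ℚ.*-assoc (sign n ℚ.* x ℚ.* y) ⟦ n C l ⟧ (B l))) ⟩
    ∑< (suc m) (λ l → w n l ℚ.* B l) ∎
    where
    x = ⟦ a C (m ∸ n) ⟧
    y = ⟦ (n + r) C n ⟧
  collapse : ∀ l → l ≤ m →
    ∑< (suc m) (λ n → w n l ℚ.* B l) ≡ sign m ℚ.* (⟦ b C (m ∸ l) ⟧ ℚ.* ⟦ (l + r) C l ⟧ ℚ.* B l)
  collapse l l≤m = begin
    ∑< (suc m) (λ n → w n l ℚ.* B l)
      ≡⟨ ∑<-*ʳ (suc m) (B l) (λ n → w n l) ⟨
    ∑< (suc m) (λ n → w n l) ℚ.* B l
      ≡⟨ cong (ℚ._* B l) (∑<-sign-C-C-C a b m r l l≤m eq) ⟩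
    sign m ℚ.* ⟦ b C (m ∸ l) ⟧ ℚ.* ⟦ (l + r) C l ⟧ ℚ.* B l
      ≡⟨ regroup′ (sign m) ⟦ b C (m ∸ l) ⟧ ⟦ (l + r) C l ⟧ (B l) ⟩
    sign m ℚ.* (⟦ b C (m ∸ l) ⟧ ℚ.* ⟦ (l + r) C l ⟧ ℚ.* B l) ∎

inner≡bernoulliSum : ∀ K a j → inner K a (suc j) ≡ bernoulliSum a (2 * K + 1 ∸ 2 * suc j) (2 * j)
inner≡bernoulliSum K a j =
  ∑<-cong (suc m) (λ n _ → cong (λ k → ⟦ a C (m ∸ n) ⟧ ℚ.* ⟦ k C n ⟧ ℚ.* B n) (index n))
  where
  m = 2 * K + 1 ∸ 2 * suc j
  index : ∀ n → n + 2 * suc j ∸ 2 ≡ n + 2 * j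
  index n = cong (_∸ 2) (rearrange n j)
    where
    rearrange : ∀ n j → n + 2 * suc j ≡ 2 + (n + 2 * j)
    rearrange = solve-ℕ

2[s+t]+1∸2s≡1+2t : ∀ s t → 2 * (s + t) + 1 ∸ 2 * s ≡ suc (2 * t)
2[s+t]+1∸2s≡1+2t s t = trans (cong (_∸ 2 * s) (rearrange s t)) (ℕ.m+n∸m≡n (2 * s) (suc (2 * t)))
  where
  rearrange : ∀ s t → 2 * (s + t) + 1 ≡ 2 * s + suc (2 * t)
  rearrange = solve-ℕ

2K+1∸2s≡1+2[K∸s] : ∀ {K s} → s ≤ K → 2 * K + 1 ∸ 2 * s ≡ suc (2 * (K ∸ s))
2K+1∸2s≡1+2[K∸s] {s = s} s≤K with ℕ.m≤n⇒∃[o]m+o≡n s≤K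
... | t , refl = trans (2[s+t]+1∸2s≡1+2t s t) (cong (λ e → suc (2 * e)) (sym (ℕ.m+n∸m≡n s t)))

2K+1∸2≡[2K+1∸2[1+j]]+2j : ∀ {K j} → suc j ≤ K →
                           2 * K + 1 ∸ 2 ≡ (2 * K + 1 ∸ 2 * suc j) + 2 * j
2K+1∸2≡[2K+1∸2[1+j]]+2j {j = j} 1+j≤K with ℕ.m≤n⇒∃[o]m+o≡n 1+j≤K
... | t , refl =
  trans (cong (_∸ 2) (rearrange j t)) (cong (_+ 2 * j) (sym (2[s+t]+1∸2s≡1+2t (suc j) t)))
  where
  rearrange : ∀ j t → 2 * (suc j + t) + 1 ≡ 2 + (suc (2 * t) + 2 * j)
  rearrange = solve-ℕ

inner-antisymmetric : ∀ K i j → suc j ≤ K → i ≤ 2 * K + 1 ∸ 2 →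
  inner K i (suc j) ≡ ℚ.- inner K (2 * K + 1 ∸ 2 ∸ i) (suc j)
inner-antisymmetric K i j 1+j≤K i≤k-2 = begin
  inner K i (suc j)                       ≡⟨ inner≡bernoulliSum K i j ⟩
  bernoulliSum i m (2 * j)                ≡⟨ bernoulliSum-reflect i b m (2 * j) i+b≡m+2j ⟩
  sign m ℚ.* bernoulliSum b m (2 * j)     ≡⟨ cong (ℚ._* bernoulliSum b m (2 * j)) sign-m ⟩
  ℚ.- 1ℚ ℚ.* bernoulliSum b m (2 * j)     ≡⟨ -1*x≡-x (bernoulliSum b m (2 * j)) ⟩
  ℚ.- bernoulliSum b m (2 * j)            ≡⟨ cong ℚ.-_ (inner≡bernoulliSum K b j) ⟨
  ℚ.- inner K b (suc j) ∎
  where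
  open ≡-Reasoning
  m = 2 * K + 1 ∸ 2 * suc j
  b = 2 * K + 1 ∸ 2 ∸ i
  sign-m : sign m ≡ ℚ.- 1ℚ
  sign-m = trans (cong sign (2K+1∸2s≡1+2[K∸s] 1+j≤K)) (sign-odd (K ∸ suc j))
  i+b≡m+2j : i + b ≡ m + 2 * j
  i+b≡m+2j = trans (ℕ.m+[n∸m]≡n i≤k-2) (2K+1∸2≡[2K+1∸2[1+j]]+2j 1+j≤K)
  -1*x≡-x : ∀ (x : ℚ) → ℚ.- 1ℚ ℚ.* x ≡ ℚ.- x
  -1*x≡-x = solve-∀ ℚ-ring

lemma2 : (K i : ℕ) → 2 ≤ K → i ≤ (2 * K + 1) ∸ 2 →
    (x y : ℚ) → F K i x y ≡ G K i x y
lemma2 K i _ i≤k-2 x y = ∑<-cong (K ∸ 1) (λ j j<K-1 → begin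
  ℚ.- c j ℚ.* inner K i (suc j) ℚ.* mono K (suc j) x y
    ≡⟨ cong (λ e → ℚ.- c j ℚ.* e ℚ.* mono K (suc j) x y)
            (inner-antisymmetric K i j (ℕ.≤-trans j<K-1 (ℕ.m∸n≤m K 1)) i≤k-2) ⟩
  ℚ.- c j ℚ.* ℚ.- inner K b (suc j) ℚ.* mono K (suc j) x y
    ≡⟨ neg*neg (c j) (inner K b (suc j)) (mono K (suc j) x y) ⟩
  c j ℚ.* inner K b (suc j) ℚ.* mono K (suc j) x y ∎)
  where
  open ≡-Reasoning
  b = 2 * K + 1 ∸ 2 ∸ i
  c : ℕ → ℚ
  c j = + 2 ℚ./ suc (2 * j)
  neg*neg : ∀ (c v w : ℚ) → ℚ.- c ℚ.* ℚ.- v ℚ.* w ≡ c ℚ.* v ℚ.* w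
  neg*neg = solve-∀ ℚ-ring
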